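{- For every integer $n\ge1$, $$x(n)=\left\lfloor \frac{11^{n^2+2n}-2\cdot 11^{n^2+n}}{11^{2n}-4\cdot 11^{n}+1}\right\rfloor \bmod 11^n .$$
   Context: $x(n)$, for $n\ge0$, denotes the $n$-th positive integer $X$ (in increasing order, starting with $x(0)=1$) such that $X^2-3Y^2=1$ for some integer $Y\ge0$. Equivalently, $x(n)+y(n)\sqrt3=(2+\sqrt3)^n$ with $x(n),y(n)\in\mathbb N$. Thus $x(0)=1$, $x(1)=2$, $x(2)=7$, $x(3)=26,\dots$. The expression $a\bmod b$ denotes the remainder of $a$ upon division by $b$. -}

module Defs where

open import Data.Nat using (ℕ; zero; suc; _+_; _*_; _∸_; _^_; _≤_; NonZero)
open import Data.Product using (_×_; _,_; proj₁)

-- (x(n), y(n)) with x(n) + y(n)√3 = (2 + √3)^n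
xy : ℕ → ℕ × ℕ
xy zero = 1 , 0
xy (suc n) with xy n
... | (a , b) = 2 * a + 3 * b , a + 2 * b

x : ℕ → ℕ
x n = proj₁ (xy n)

-- numerator and denominator (as natural numbers; both are positive for n ≥ 1)
num : ℕ → ℕ
num n = 11 ^ (n * n + 2 * n) ∸ 2 * 11 ^ (n * n + n)

den : ℕ → ℕ
den n = 11 ^ (2 * n) + 1 ∸ 4 * 11 ^ n

-- With t = 11^n and d = t² − 4t + 1, the numerator is t^(n+2) − 2t^(n+1), and since
-- x(m+2) + x(m) = 4x(m+1) one has the exact division
--   t^(m+2) − 2t^(m+1) = d · (x(0)t^m + x(1)t^(m-1) + … + x(m)) + (x(m+1)t − x(m)),
-- whose remainder lies in [0, d) as soon as x(m+1) + 4 ≤ t.  Taking m = n, the floor is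
-- the base-t number with digits x(0), …, x(n), whose last digit x(n) is its residue mod t.
module Submission where

open import Defs
open import Data.Nat using (ℕ; zero; suc; _+_; _*_; _∸_; _^_; _≤_; _<_; NonZero; >-nonZero; s≤s; z≤n)
open import Data.Nat.Properties
open import Data.Nat.DivMod using (_/_; _%_; +-distrib-/-∣ʳ; m<n⇒m/n≡0; m*n/n≡m; [m+kn]%n≡m%n; m<n⇒m%n≡m)
open import Data.Nat.Divisibility using (divides)
open import Data.Nat.Tactic.RingSolver using (solve-∀)
open import Data.Product using (proj₂)
open import Relation.Binary.PropositionalEquality using (_≡_; refl; sym; trans; cong; cong₂; subst; module ≡-Reasoning)

[r+q*d]/d≡q : ∀ r q d .{{_ : NonZero d}} → r < d → (r + q * d) / d ≡ q
[r+q*d]/d≡q r q d r<d = begin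
  (r + q * d) / d      ≡⟨ +-distrib-/-∣ʳ r (divides q refl) ⟩
  r / d + q * d / d    ≡⟨ cong₂ _+_ (m<n⇒m/n≡0 r<d) (m*n/n≡m q d) ⟩
  q                    ∎
  where open ≡-Reasoning

y : ℕ → ℕ
y n = proj₂ (xy n)

x-recurrence : ∀ m → x (suc (suc m)) + x m ≡ 4 * x (suc m)
x-recurrence m = identity (x m) (y m)
  where
  identity : ∀ a b → (2 * (2 * a + 3 * b) + 3 * (a + 2 * b)) + a ≡ 4 * (2 * a + 3 * b)
  identity = solve-∀

x-monotone : ∀ m → x m ≤ x (suc m)
x-monotone m = ≤-trans (m≤m+n (x m) (x m + 0)) (m≤m+n (2 * x m) (3 * y m))

x[2+m]≤4*x[1+m] : ∀ m → x (suc (suc m)) ≤ 4 * x (suc m)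
x[2+m]≤4*x[1+m] m = subst (x (suc (suc m)) ≤_) (x-recurrence m) (m≤m+n _ _)

x[2+k]+4≤11^[1+k] : ∀ k → x (suc (suc k)) + 4 ≤ 11 ^ suc k
x[2+k]+4≤11^[1+k] zero = ≤-refl
x[2+k]+4≤11^[1+k] (suc k) = begin
  x (3 + k) + 4            ≤⟨ +-monoˡ-≤ 4 (x[2+m]≤4*x[1+m] (suc k)) ⟩
  4 * x (2 + k) + 4        ≤⟨ m≤m+n _ 12 ⟩
  4 * x (2 + k) + 4 + 12   ≡⟨ factor (x (2 + k)) ⟩
  4 * (x (2 + k) + 4)      ≤⟨ *-monoʳ-≤ 4 (x[2+k]+4≤11^[1+k] k) ⟩
  4 * 11 ^ suc k           ≤⟨ *-monoˡ-≤ (11 ^ suc k) (m≤m+n 4 7) ⟩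
  11 * 11 ^ suc k          ∎
  where
  open ≤-Reasoning
  factor : ∀ a → 4 * a + 4 + 12 ≡ 4 * (a + 4)
  factor = solve-∀

horner : ℕ → ℕ → ℕ
horner t zero    = x zero
horner t (suc m) = x (suc m) + horner t m * t

horner%t≡x : ∀ t .{{_ : NonZero t}} m → x m < t → horner t m % t ≡ x m
horner%t≡x t zero    x<t = m<n⇒m%n≡m x<t
horner%t≡x t (suc m) x<t = trans ([m+kn]%n≡m%n (x (suc m)) (horner t m) t) (m<n⇒m%n≡m x<t)

-- The division identity, with the subtracted terms moved across so that it is stated in ℕ.
horner-division : ∀ t d → d + 4 * t ≡ t * t + 1 → ∀ m →
  d * horner t m + x (suc m) * t + 2 * t ^ suc m ≡ t ^ suc (suc m) + x m
horner-division t d d+4t≡t²+1 zero = begin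
  d * 1 + 2 * t + 2 * (t * 1)   ≡⟨ base d t ⟩
  d + 4 * t                     ≡⟨ d+4t≡t²+1 ⟩
  t * t + 1                     ≡⟨ cong (λ s → t * s + 1) (sym (*-identityʳ t)) ⟩
  t * (t * 1) + 1               ∎
  where
  open ≡-Reasoning
  base : ∀ d t → d * 1 + 2 * t + 2 * (t * 1) ≡ d + 4 * t
  base = solve-∀
horner-division t d d+4t≡t²+1 (suc m) = +-cancelʳ-≡ surplus _ _ (begin
  (d * horner t (suc m) + x₂ * t + 2 * t ^ suc (suc m)) + surplus
    ≡⟨ regroup d (horner t m) x₀ x₁ x₂ t (t ^ suc m) ⟩
  t * (d * horner t m + x₁ * t + 2 * t ^ suc m) + x₁ * (d + 4 * t) + t * (x₂ + x₀)
    ≡⟨ cong₂ _+_ (cong₂ _+_ (cong (t *_) (horner-division t d d+4t≡t²+1 m))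
                            (cong (x₁ *_) d+4t≡t²+1))
                 (cong (t *_) (x-recurrence m)) ⟩
  t * (t ^ suc (suc m) + x₀) + x₁ * (t * t + 1) + t * (4 * x₁)
    ≡⟨ collect x₀ x₁ t (t ^ m) ⟩
  (t ^ suc (suc (suc m)) + x₁) + surplus
    ∎)
  where
  open ≡-Reasoning
  x₀ = x m
  x₁ = x (suc m)
  x₂ = x (suc (suc m))
  surplus = x₁ * t * t + 4 * t * x₁ + x₀ * t
  regroup : ∀ d h x₀ x₁ x₂ t p →
    (d * (x₁ + h * t) + x₂ * t + 2 * (t * p)) + (x₁ * t * t + 4 * t * x₁ + x₀ * t)
    ≡ t * (d * h + x₁ * t + 2 * p) + x₁ * (d + 4 * t) + t * (x₂ + x₀)
  regroup = solve-∀
  collect : ∀ x₀ x₁ t p →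
    t * (t * (t * p) + x₀) + x₁ * (t * t + 1) + t * (4 * x₁)
    ≡ (t * (t * (t * p)) + x₁) + (x₁ * t * t + 4 * t * x₁ + x₀ * t)
  collect = solve-∀

a*t<d : ∀ a t d → a + 4 ≤ t → d + 4 * t ≡ t * t + 1 → a * t < d
a*t<d a t d a+4≤t d+4t≡t²+1 = +-cancelʳ-≤ (4 * t) (suc (a * t)) d (begin
  suc (a * t) + 4 * t   ≡⟨ cong suc (sym (*-distribʳ-+ t a 4)) ⟩
  suc ((a + 4) * t)     ≤⟨ s≤s (*-monoˡ-≤ t a+4≤t) ⟩
  suc (t * t)           ≡⟨ +-comm 1 (t * t) ⟩
  t * t + 1             ≡⟨ d+4t≡t²+1 ⟨
  d + 4 * t             ∎)
  where open ≤-Reasoning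

horner-quotient : ∀ t d .{{_ : NonZero d}} → d + 4 * t ≡ t * t + 1 → ∀ m →
  x (suc m) + 4 ≤ t → (t ^ suc (suc m) ∸ 2 * t ^ suc m) / d ≡ horner t m
horner-quotient t d d+4t≡t²+1 m x₁+4≤t = begin
  (t ^ suc (suc m) ∸ 2 * t ^ suc m) / d   ≡⟨ cong (_/ d) numerator≡ ⟩
  (r + horner t m * d) / d                ≡⟨ [r+q*d]/d≡q r (horner t m) d r<d ⟩
  horner t m                              ∎
  where
  open ≡-Reasoning
  x₀ = x m
  x₁ = x (suc m)
  r = x₁ * t ∸ x₀
  x₀≤x₁*t : x₀ ≤ x₁ * t
  x₀≤x₁*t = ≤-trans (x-monotone m) (m≤m*n x₁ t)
    where instance _ = >-nonZero (≤-trans (s≤s z≤n) (≤-trans (m≤n+m 4 x₁) x₁+4≤t))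
  division : d * horner t m + r + 2 * t ^ suc m ≡ t ^ suc (suc m)
  division = +-cancelʳ-≡ x₀ _ _ (begin
    d * horner t m + r + 2 * t ^ suc m + x₀     ≡⟨ swap (d * horner t m) r (2 * t ^ suc m) x₀ ⟩
    d * horner t m + (r + x₀) + 2 * t ^ suc m   ≡⟨ cong (λ s → d * horner t m + s + 2 * t ^ suc m) (m∸n+n≡m x₀≤x₁*t) ⟩
    d * horner t m + x₁ * t + 2 * t ^ suc m     ≡⟨ horner-division t d d+4t≡t²+1 m ⟩
    t ^ suc (suc m) + x₀                        ∎)
    where
    swap : ∀ a b c e → a + b + c + e ≡ a + (b + e) + c
    swap = solve-∀
  numerator≡ : t ^ suc (suc m) ∸ 2 * t ^ suc m ≡ r + horner t m * d
  numerator≡ = begin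
    t ^ suc (suc m) ∸ 2 * t ^ suc m                     ≡⟨ cong (_∸ 2 * t ^ suc m) (sym division) ⟩
    d * horner t m + r + 2 * t ^ suc m ∸ 2 * t ^ suc m  ≡⟨ m+n∸n≡m (d * horner t m + r) (2 * t ^ suc m) ⟩
    d * horner t m + r                                  ≡⟨ +-comm (d * horner t m) r ⟩
    r + d * horner t m                                  ≡⟨ cong (r +_) (*-comm d (horner t m)) ⟩
    r + horner t m * d                                  ∎
  r<d : r < d
  r<d = ≤-<-trans (m∸n≤m (x₁ * t) x₀) (a*t<d x₁ t d x₁+4≤t d+4t≡t²+1)

num≡ : ∀ n → num n ≡ (11 ^ n) ^ suc (suc n) ∸ 2 * (11 ^ n) ^ suc n
num≡ n = cong₂ (λ a b → a ∸ 2 * b) (power (suc (suc n)) (exponent₂ n)) (power (suc n) (exponent₁ n))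
  where
  power : ∀ {e} k → e ≡ n * k → 11 ^ e ≡ (11 ^ n) ^ k
  power k e≡n*k = trans (cong (11 ^_) e≡n*k) (sym (^-*-assoc 11 n k))
  exponent₂ : ∀ n → n * n + 2 * n ≡ n * (2 + n)
  exponent₂ = solve-∀
  exponent₁ : ∀ n → n * n + n ≡ n * (1 + n)
  exponent₁ = solve-∀

den+4t≡t²+1 : ∀ n → 4 ≤ 11 ^ n → den n + 4 * 11 ^ n ≡ 11 ^ n * 11 ^ n + 1
den+4t≡t²+1 n 4≤t = begin
  11 ^ (2 * n) + 1 ∸ 4 * t + 4 * t   ≡⟨ cong (λ s → s + 1 ∸ 4 * t + 4 * t) square ⟩
  t * t + 1 ∸ 4 * t + 4 * t          ≡⟨ m∸n+n≡m (≤-trans (*-monoˡ-≤ t 4≤t) (m≤m+n (t * t) 1)) ⟩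
  t * t + 1                          ∎
  where
  open ≡-Reasoning
  t = 11 ^ n
  square : 11 ^ (2 * n) ≡ t * t
  square = trans (cong (11 ^_) (*-comm 2 n)) (trans (sym (^-*-assoc 11 n 2)) (cong (t *_) (*-identityʳ t)))

mainTheorem5 : (n : ℕ) → 1 ≤ n → .{{_ : NonZero (den n)}} →
    x n ≡ _%_ (num n / den n) (11 ^ n) {{m^n≢0 11 n}}
mainTheorem5 n@(suc k) _ = sym (begin
  num n / den n % t                              ≡⟨ cong (λ q → q / den n % t) (num≡ n) ⟩
  (t ^ suc (suc n) ∸ 2 * t ^ suc n) / den n % t  ≡⟨ cong (_% t) (horner-quotient t (den n) den-eq n bound) ⟩
  horner t n % t                                 ≡⟨ horner%t≡x t n x<t ⟩
  x n                                            ∎)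
  where
  open ≡-Reasoning
  t = 11 ^ n
  instance _ = m^n≢0 11 n
  bound : x (suc n) + 4 ≤ t
  bound = x[2+k]+4≤11^[1+k] k
  x<t : x n < t
  x<t = ≤-<-trans (x-monotone n) (<-≤-trans (m<m+n (x (suc n)) (s≤s z≤n)) bound)
  den-eq : den n + 4 * t ≡ t * t + 1
  den-eq = den+4t≡t²+1 n (≤-trans (m≤n+m 4 (x (suc n))) bound)
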